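{- For $n\ge1$ and $r\ge1$, the number of (nonempty) partitions of perimeter $2n+2$ and rank $r$ equals $\binom{n}{2r-1}$.
   Context: For a nonempty partition $\lambda$, its perimeter is $2(\lambda_1+\ell(\lambda))$, where $\lambda_1$ is the largest part and $\ell(\lambda)$ the number of parts (i.e. the boundary length of its Young diagram). Its rank is the Durfee rank, i.e. the largest $r$ with $\lambda_r\ge r$ (the number of cells on the main diagonal of its Young diagram). -}

module Defs where

open import Data.Nat using (ℕ; zero; suc; _+_; _*_; _≤_; _≥_; _≤?_; _≟_)
open import Data.List using (List; []; _∷_; length)
open import Data.List.Relation.Unary.All using (All)
open import Data.List.Relation.Unary.Linked using (Linked)
open import Data.List.Membership.Propositional using (_∈_)
open import Data.List.Relation.Unary.Unique.Propositional using (Unique)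
open import Data.Product using (_×_; Σ)
open import Relation.Binary.PropositionalEquality using (_≡_)
open import Relation.Nullary using (does)
open import Data.Bool using (if_then_else_)

record IsNonemptyPartition (λs : List ℕ) : Set where
  field
    nonempty   : 0 Data.Nat.< length λs
    positive   : All (λ p → 1 ≤ p) λs
    decreasing : Linked _≥_ λs

largestPart : List ℕ → ℕ
largestPart []      = 0
largestPart (x ∷ _) = x

perimeter : List ℕ → ℕ
perimeter λs = 2 * (largestPart λs + length λs)

-- Durfee rank: largest r with λ_r ≥ r.  Since λ is weakly decreasing,
-- {r : λ_r ≥ r} is an initial segment {1,…,r}, so we scan i = 1,2,…
-- while λ_i ≥ i.
durfeeFrom : ℕ → List ℕ → ℕ
durfeeFrom i []       = 0
durfeeFrom i (x ∷ xs) = if does (i ≤? x) then suc (durfeeFrom (suc i) xs) else 0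

rank : List ℕ → ℕ
rank = durfeeFrom 1

module Submission where

-- Cut a partition of rank r = p + 1 along its Durfee square: the first r parts are all ≥ r and
-- the remaining ones are all ≤ r. If the largest part is a + 1 and there are j + 1 parts, the
-- top is a + 1 followed by a decreasing list of p parts in [r, a + 1], and the bottom is a
-- decreasing list of j − p parts in [1, r]; there are C(a, p) and C(j, p) of these. Perimeter
-- 2n + 2 means a + j = n − 1, and the sum of C(a, p) C(j, p) over a + j = n − 1 is C(n, 2p + 1).

open import Defs
open import Data.Nat using (ℕ; zero; suc; _+_; _*_; _∸_; _≤_; _<_; _≥_; _≤?_; _≟_; z≤n; s≤s)
open import Data.Nat.Properties
open import Data.Nat.Combinatorics using (_C_; nCn≡1; nCk≡nC[n∸k]; nCk+nC[k+1]≡[n+1]C[k+1]; k>n⇒nCk≡0)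
open import Data.Nat.Tactic.RingSolver using (solve-∀)
open import Algebra.Properties.CommutativeSemigroup +-commutativeSemigroup
  using () renaming (interchange to +-interchange)
open import Data.List using (List; []; _∷_; length; map; _++_; cartesianProductWith)
open import Data.List.Properties using (length-++; length-map; ∷-injectiveˡ; ∷-injectiveʳ; ++-cancelˡ)
open import Data.List.Relation.Unary.All as All using (All; []; _∷_)
import Data.List.Relation.Unary.All.Properties as All
open import Data.List.Relation.Unary.Any using (here)
open import Data.List.Relation.Unary.Linked as Linked using (Linked; []; [-]; _∷_)
open import Data.List.Relation.Unary.Linked.Properties using (Linked⇒All)
open import Data.List.Membership.Propositional using (_∈_)
open import Data.List.Membership.Propositional.Properties
  using (∈-map⁺; ∈-map⁻; ∈-++⁺ˡ; ∈-++⁺ʳ; ∈-++⁻; ∈-cartesianProductWith⁺; ∈-cartesianProductWith⁻)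
open import Data.List.Relation.Unary.Unique.Propositional using (Unique; []; _∷_)
import Data.List.Relation.Unary.Unique.Propositional.Properties as Unique
open import Data.Product using (Σ; ∃; ∃₂; _×_; _,_; proj₁; proj₂)
open import Data.Sum using (inj₁; inj₂)
open import Function using (_∘_)
open import Function.Bundles using (_⇔_; mk⇔; Equivalence)
open import Relation.Binary.PropositionalEquality
open import Relation.Nullary using (yes; no; ¬_; contradiction)
open import Relation.Nullary.Decidable using (dec-true; dec-false)

-- Weakly decreasing lists

Decreasing : List ℕ → Set
Decreasing = Linked _≥_

decreasing-∷⁺ : ∀ {x xs} → All (_≤ x) xs → Decreasing xs → Decreasing (x ∷ xs)
decreasing-∷⁺ []        _ = [-]
decreasing-∷⁺ (y≤x ∷ _) d = y≤x ∷ d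

decreasing-∷⁻ : ∀ {x xs} → Decreasing (x ∷ xs) → All (_≤ x) xs
decreasing-∷⁻ d = All.tail (Linked⇒All (λ j≤i k≤j → ≤-trans k≤j j≤i) ≤-refl d)

decreasing-++⁺ : ∀ {c xs ys} → All (c ≤_) xs → All (_≤ c) ys →
                 Decreasing xs → Decreasing ys → Decreasing (xs ++ ys)
decreasing-++⁺ []          _   _   dys = dys
decreasing-++⁺ (c≤x ∷ cxs) ycs dxs dys =
  decreasing-∷⁺ (All.++⁺ (decreasing-∷⁻ dxs) (All.map (λ y≤c → ≤-trans y≤c c≤x) ycs))
                (decreasing-++⁺ cxs ycs (Linked.tail dxs) dys)

decreasing-++⁻ˡ : ∀ xs {ys} → Decreasing (xs ++ ys) → Decreasing xs
decreasing-++⁻ˡ []           _       = []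
decreasing-++⁻ˡ (x ∷ [])     _       = [-]
decreasing-++⁻ˡ (x ∷ y ∷ xs) (h ∷ d) = h ∷ decreasing-++⁻ˡ (y ∷ xs) d

decreasing-++⁻ʳ : ∀ xs {ys} → Decreasing (xs ++ ys) → Decreasing ys
decreasing-++⁻ʳ []       d = d
decreasing-++⁻ʳ (x ∷ xs) d = decreasing-++⁻ʳ xs (Linked.tail d)

DecreasingIn : ℕ → ℕ → ℕ → List ℕ → Set
DecreasingIn k lo hi xs = length xs ≡ k × Decreasing xs × All (λ x → lo ≤ x × x ≤ hi) xs

decreasingLists : ℕ → ℕ → ℕ → List (List ℕ)
decreasingLists zero    lo d       = [] ∷ []
decreasingLists (suc k) lo zero    = map (lo + 0 ∷_) (decreasingLists k lo 0)
decreasingLists (suc k) lo (suc d) =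
  map (lo + suc d ∷_) (decreasingLists k lo (suc d)) ++ decreasingLists (suc k) lo d

module _ {k lo d : ℕ} where

  decreasingIn-∷ : ∀ {xs} → DecreasingIn k lo (lo + d) xs →
                   DecreasingIn (suc k) lo (lo + d) (lo + d ∷ xs)
  decreasingIn-∷ (refl , dxs , bounds) =
    refl , decreasing-∷⁺ (All.map proj₂ bounds) dxs , (m≤m+n lo d , ≤-refl) ∷ bounds

  decreasingIn-weaken : ∀ {xs} → DecreasingIn k lo (lo + d) xs → DecreasingIn k lo (lo + suc d) xs
  decreasingIn-weaken (len , dxs , bounds) =
    len , dxs , All.map (λ (lo≤x , x≤) → lo≤x , ≤-trans x≤ (+-monoʳ-≤ lo (n≤1+n d))) bounds

∈-decreasingLists⁻ : ∀ k lo d {xs} → xs ∈ decreasingLists k lo d → DecreasingIn k lo (lo + d) xs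
∈-decreasingLists⁻ zero    lo d       (here refl) = refl , [] , []
∈-decreasingLists⁻ (suc k) lo zero    xs∈
  with ys , ys∈ , refl ← ∈-map⁻ (lo + 0 ∷_) xs∈ = decreasingIn-∷ (∈-decreasingLists⁻ k lo 0 ys∈)
∈-decreasingLists⁻ (suc k) lo (suc d) xs∈
  with ∈-++⁻ (map (lo + suc d ∷_) (decreasingLists k lo (suc d))) xs∈
... | inj₁ xs∈head with ys , ys∈ , refl ← ∈-map⁻ (lo + suc d ∷_) xs∈head =
  decreasingIn-∷ (∈-decreasingLists⁻ k lo (suc d) ys∈)
... | inj₂ xs∈rest = decreasingIn-weaken (∈-decreasingLists⁻ (suc k) lo d xs∈rest)

∈-decreasingLists⁺ : ∀ k lo d {xs} → DecreasingIn k lo (lo + d) xs → xs ∈ decreasingLists k lo d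
∈-decreasingLists⁺ zero    lo d {[]}     _ = here refl
∈-decreasingLists⁺ (suc k) lo d {x ∷ xs} (len , dxs , (lo≤x , x≤) ∷ bounds) with x ≟ lo + d
... | yes refl =
  maximalHead d (∈-decreasingLists⁺ k lo d (suc-injective len , Linked.tail dxs , tailBounds))
  where
  tailBounds : All (λ y → lo ≤ y × y ≤ lo + d) xs
  tailBounds = All.zip (All.map proj₁ bounds , decreasing-∷⁻ dxs)
  maximalHead : ∀ d {ys} → ys ∈ decreasingLists k lo d → (lo + d ∷ ys) ∈ decreasingLists (suc k) lo d
  maximalHead zero    ys∈ = ∈-map⁺ (lo + 0 ∷_) ys∈
  maximalHead (suc d) ys∈ = ∈-++⁺ˡ (∈-map⁺ (lo + suc d ∷_) ys∈)
∈-decreasingLists⁺ (suc k) lo zero    {x ∷ xs} (_ , _ , (lo≤x , x≤) ∷ _) | no x≢ =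
  contradiction (≤-antisym x≤ (subst (_≤ x) (sym (+-identityʳ lo)) lo≤x)) x≢
∈-decreasingLists⁺ (suc k) lo (suc d) {x ∷ xs} (len , dxs , (lo≤x , x≤) ∷ bounds) | no x≢ =
  ∈-++⁺ʳ (map (lo + suc d ∷_) (decreasingLists k lo (suc d)))
    (∈-decreasingLists⁺ (suc k) lo d (len , dxs , (lo≤x , x≤') ∷ tailBounds))
  where
  x≤' : x ≤ lo + d
  x≤' = ≤-pred (subst (x <_) (+-suc lo d) (≤∧≢⇒< x≤ x≢))
  tailBounds : All (λ y → lo ≤ y × y ≤ lo + d) xs
  tailBounds = All.zip (All.map proj₁ bounds , All.map (λ y≤x → ≤-trans y≤x x≤') (decreasing-∷⁻ dxs))

decreasingLists-unique : ∀ k lo d → Unique (decreasingLists k lo d)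
decreasingLists-unique zero    lo d       = [] ∷ []
decreasingLists-unique (suc k) lo zero    = Unique.map⁺ ∷-injectiveʳ (decreasingLists-unique k lo 0)
decreasingLists-unique (suc k) lo (suc d) =
  Unique.++⁺ (Unique.map⁺ ∷-injectiveʳ (decreasingLists-unique k lo (suc d)))
             (decreasingLists-unique (suc k) lo d)
             headsDiffer
  where
  headsDiffer : ∀ {xs} → ¬ (xs ∈ map (lo + suc d ∷_) (decreasingLists k lo (suc d)) ×
                            xs ∈ decreasingLists (suc k) lo d)
  headsDiffer (xs∈head , xs∈rest) with ys , _ , refl ← ∈-map⁻ (lo + suc d ∷_) xs∈head
    with _ , _ , (_ , x≤) ∷ _ ← ∈-decreasingLists⁻ (suc k) lo d xs∈rest =
    <-irrefl refl (subst (_≤ lo + d) (+-suc lo d) x≤)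

length-decreasingLists : ∀ k lo d → length (decreasingLists k lo d) ≡ (d + k) C k
length-decreasingLists zero    lo d       = refl
length-decreasingLists (suc k) lo zero    = begin
  length (map (lo + 0 ∷_) (decreasingLists k lo 0)) ≡⟨ length-map (lo + 0 ∷_) (decreasingLists k lo 0) ⟩
  length (decreasingLists k lo 0)                   ≡⟨ length-decreasingLists k lo 0 ⟩
  k C k                                             ≡⟨ nCn≡1 k ⟩
  1                                                 ≡⟨ nCn≡1 (suc k) ⟨
  suc k C suc k                                     ∎
  where open ≡-Reasoning
length-decreasingLists (suc k) lo (suc d) = begin
  length (map (lo + suc d ∷_) (decreasingLists k lo (suc d)) ++ decreasingLists (suc k) lo d)
    ≡⟨ length-++ (map (lo + suc d ∷_) (decreasingLists k lo (suc d))) ⟩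
  length (map (lo + suc d ∷_) (decreasingLists k lo (suc d))) + length (decreasingLists (suc k) lo d)
    ≡⟨ cong₂ _+_ (trans (length-map (lo + suc d ∷_) (decreasingLists k lo (suc d)))
                        (length-decreasingLists k lo (suc d)))
                 (length-decreasingLists (suc k) lo d) ⟩
  (suc d + k) C k + (d + suc k) C suc k
    ≡⟨ cong (λ n → n C k + (d + suc k) C suc k) (+-suc d k) ⟨
  (d + suc k) C k + (d + suc k) C suc k
    ≡⟨ nCk+nC[k+1]≡[n+1]C[k+1] (d + suc k) k ⟩
  (suc d + suc k) C suc k ∎
  where open ≡-Reasoning

-- Sums and concatenations over the antidiagonal i + j = m

antidiagonalSum : (ℕ → ℕ → ℕ) → ℕ → ℕ
antidiagonalSum h zero    = h 0 0
antidiagonalSum h (suc m) = h 0 (suc m) + antidiagonalSum (h ∘ suc) m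

antidiagonalSum-cong : ∀ {h h′ : ℕ → ℕ → ℕ} m → (∀ i j → h i j ≡ h′ i j) →
                       antidiagonalSum h m ≡ antidiagonalSum h′ m
antidiagonalSum-cong zero    h≗h′ = h≗h′ 0 0
antidiagonalSum-cong (suc m) h≗h′ = cong₂ _+_ (h≗h′ 0 (suc m)) (antidiagonalSum-cong m (h≗h′ ∘ suc))

antidiagonalSum-+ : ∀ (g h : ℕ → ℕ → ℕ) m →
                    antidiagonalSum (λ i j → g i j + h i j) m ≡ antidiagonalSum g m + antidiagonalSum h m
antidiagonalSum-+ g h zero    = refl
antidiagonalSum-+ g h (suc m) = begin
  (g 0 (suc m) + h 0 (suc m)) + antidiagonalSum (λ i j → g (suc i) j + h (suc i) j) m
    ≡⟨ cong (g 0 (suc m) + h 0 (suc m) +_) (antidiagonalSum-+ (g ∘ suc) (h ∘ suc) m) ⟩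
  (g 0 (suc m) + h 0 (suc m)) + (antidiagonalSum (g ∘ suc) m + antidiagonalSum (h ∘ suc) m)
    ≡⟨ +-interchange (g 0 (suc m)) (h 0 (suc m)) _ _ ⟩
  (g 0 (suc m) + antidiagonalSum (g ∘ suc) m) + (h 0 (suc m) + antidiagonalSum (h ∘ suc) m) ∎
  where open ≡-Reasoning

antidiagonalSum-binomial : ∀ m p q → antidiagonalSum (λ i j → (i C p) * (j C q)) m ≡ suc m C suc (p + q)
antidiagonalSum-binomial zero    zero    zero    = refl
antidiagonalSum-binomial zero    zero    (suc q) = refl
antidiagonalSum-binomial zero    (suc p) q       = refl
antidiagonalSum-binomial (suc m) zero    q       = begin
  1 * (suc m C q) + antidiagonalSum (λ i j → (i C 0) * (j C q)) m
    ≡⟨ cong₂ _+_ (*-identityˡ (suc m C q)) (antidiagonalSum-binomial m 0 q) ⟩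
  suc m C q + suc m C suc q ≡⟨ nCk+nC[k+1]≡[n+1]C[k+1] (suc m) q ⟩
  suc (suc m) C suc q       ∎
  where open ≡-Reasoning
antidiagonalSum-binomial (suc m) (suc p) q = begin
  antidiagonalSum (λ i j → (suc i C suc p) * (j C q)) m
    ≡⟨ antidiagonalSum-cong m pascal ⟩
  antidiagonalSum (λ i j → (i C p) * (j C q) + (i C suc p) * (j C q)) m
    ≡⟨ antidiagonalSum-+ (λ i j → (i C p) * (j C q)) (λ i j → (i C suc p) * (j C q)) m ⟩
  antidiagonalSum (λ i j → (i C p) * (j C q)) m + antidiagonalSum (λ i j → (i C suc p) * (j C q)) m
    ≡⟨ cong₂ _+_ (antidiagonalSum-binomial m p q) (antidiagonalSum-binomial m (suc p) q) ⟩
  suc m C suc (p + q) + suc m C suc (suc p + q)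
    ≡⟨ nCk+nC[k+1]≡[n+1]C[k+1] (suc m) (suc (p + q)) ⟩
  suc (suc m) C suc (suc p + q) ∎
  where
  open ≡-Reasoning
  pascal : ∀ i j → (suc i C suc p) * (j C q) ≡ (i C p) * (j C q) + (i C suc p) * (j C q)
  pascal i j = trans (cong (_* (j C q)) (sym (nCk+nC[k+1]≡[n+1]C[k+1] i p)))
                     (*-distribʳ-+ (j C q) (i C p) (i C suc p))

module _ {A : Set} where

  antidiagonalConcat : (ℕ → ℕ → List A) → ℕ → List A
  antidiagonalConcat h zero    = h 0 0
  antidiagonalConcat h (suc m) = h 0 (suc m) ++ antidiagonalConcat (h ∘ suc) m

  ∈-antidiagonalConcat⁻ : ∀ h m {v} → v ∈ antidiagonalConcat h m → ∃₂ λ i j → i + j ≡ m × v ∈ h i j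
  ∈-antidiagonalConcat⁻ h zero    v∈ = 0 , 0 , refl , v∈
  ∈-antidiagonalConcat⁻ h (suc m) v∈ with ∈-++⁻ (h 0 (suc m)) v∈
  ... | inj₁ v∈first = 0 , suc m , refl , v∈first
  ... | inj₂ v∈rest with i , j , i+j≡m , v∈h ← ∈-antidiagonalConcat⁻ (h ∘ suc) m v∈rest =
    suc i , j , cong suc i+j≡m , v∈h

  ∈-antidiagonalConcat⁺ : ∀ h {i j m v} → i + j ≡ m → v ∈ h i j → v ∈ antidiagonalConcat h m
  ∈-antidiagonalConcat⁺ h {zero}  {m = zero}  refl v∈ = v∈
  ∈-antidiagonalConcat⁺ h {zero}  {m = suc m} refl v∈ = ∈-++⁺ˡ v∈
  ∈-antidiagonalConcat⁺ h {suc i} {m = suc m} i+j≡m v∈ =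
    ∈-++⁺ʳ (h 0 (suc m)) (∈-antidiagonalConcat⁺ (h ∘ suc) (suc-injective i+j≡m) v∈)

  antidiagonalConcat-unique : ∀ h m → (∀ i j → Unique (h i j)) →
                              (∀ {i j i′ j′ v} → v ∈ h i j → v ∈ h i′ j′ → i ≡ i′) →
                              Unique (antidiagonalConcat h m)
  antidiagonalConcat-unique h zero    h-unique _        = h-unique 0 0
  antidiagonalConcat-unique h (suc m) h-unique rowsDisjoint =
    Unique.++⁺ (h-unique 0 (suc m))
               (antidiagonalConcat-unique (h ∘ suc) m (h-unique ∘ suc)
                                          (λ v∈ v∈′ → suc-injective (rowsDisjoint v∈ v∈′)))
               (λ (v∈first , v∈rest) →
                 let _ , _ , _ , v∈h = ∈-antidiagonalConcat⁻ (h ∘ suc) m v∈rest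
                 in  0≢1+n (rowsDisjoint v∈first v∈h))

  length-antidiagonalConcat : ∀ h m →
                              length (antidiagonalConcat h m) ≡ antidiagonalSum (λ i j → length (h i j)) m
  length-antidiagonalConcat h zero    = refl
  length-antidiagonalConcat h (suc m) =
    trans (length-++ (h 0 (suc m))) (cong (length (h 0 (suc m)) +_) (length-antidiagonalConcat (h ∘ suc) m))

  length-cartesianProductWith : ∀ {B C : Set} (f : B → C → A) xs ys →
                                length (cartesianProductWith f xs ys) ≡ length xs * length ys
  length-cartesianProductWith f []       ys = refl
  length-cartesianProductWith f (x ∷ xs) ys =
    trans (length-++ (map (f x) ys))
          (cong₂ _+_ (length-map (f x) ys) (length-cartesianProductWith f xs ys))

  ++-injectiveˡ : ∀ (xs xs′ : List A) {ys ys′} → length xs ≡ length xs′ → xs ++ ys ≡ xs′ ++ ys′ → xs ≡ xs′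
  ++-injectiveˡ []       []         _   _  = refl
  ++-injectiveˡ (x ∷ xs) (x′ ∷ xs′) len eq =
    cong₂ _∷_ (∷-injectiveˡ eq) (++-injectiveˡ xs xs′ (suc-injective len) (∷-injectiveʳ eq))

  cartesianProductWith-++-unique : ∀ {n xs ys} → All (λ x → length x ≡ n) xs → Unique xs → Unique ys →
                               Unique (cartesianProductWith _++_ xs ys)
  cartesianProductWith-++-unique []            []          _    = []
  cartesianProductWith-++-unique {n} {x ∷ xs} {ys} (|x| ∷ |xs|) (x∉xs ∷ xs!) ys! =
    Unique.++⁺ (Unique.map⁺ (++-cancelˡ x _ _) ys!)
               (cartesianProductWith-++-unique |xs| xs! ys!)
               prefixesDiffer
    where
    prefixesDiffer : ∀ {v} → ¬ (v ∈ map (x ++_) ys × v ∈ cartesianProductWith _++_ xs ys)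
    prefixesDiffer (v∈first , v∈rest)
      with _ , _ , refl ← ∈-map⁻ (x ++_) v∈first
      with x′ , _ , x′∈xs , _ , eq ← ∈-cartesianProductWith⁻ _++_ xs ys v∈rest =
      All.lookup x∉xs x′∈xs (++-injectiveˡ x x′ (trans |x| (sym (All.lookup |xs| x′∈xs))) eq)

-- Durfee rank

durfeeFrom-≤ : ∀ {i x} xs → i ≤ x → durfeeFrom i (x ∷ xs) ≡ suc (durfeeFrom (suc i) xs)
durfeeFrom-≤ {i} {x} xs i≤x rewrite dec-true (i ≤? x) i≤x = refl

durfeeFrom-≰ : ∀ {i x} xs → ¬ i ≤ x → durfeeFrom i (x ∷ xs) ≡ 0
durfeeFrom-≰ {i} {x} xs i≰x rewrite dec-false (i ≤? x) i≰x = refl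

durfeeFrom-++ : ∀ {i n} t {b} → i + length t ≡ n → All (λ x → n ≤ suc x) t → All (_< n) b →
                durfeeFrom i (t ++ b) ≡ length t
durfeeFrom-++ {i} []      {[]}    _     _  _          = refl
durfeeFrom-++ {i} []      {x ∷ b} i+0≡n _  (x<n ∷ _) =
  durfeeFrom-≰ b (<⇒≱ (subst (x <_) (trans (sym i+0≡n) (+-identityʳ i)) x<n))
durfeeFrom-++ {i} {n} (x ∷ t) {b} i+|x∷t|≡n (n≤1+x ∷ ts) bs =
  trans (durfeeFrom-≤ (t ++ b) i≤x) (cong suc (durfeeFrom-++ t 1+i+|t|≡n ts bs))
  where
  1+i+|t|≡n : suc i + length t ≡ n
  1+i+|t|≡n = trans (sym (+-suc i (length t))) i+|x∷t|≡n
  i≤x : i ≤ x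
  i≤x = ≤-pred (≤-trans (s≤s (m≤m+n i (length t))) (≤-trans (≤-reflexive 1+i+|t|≡n) n≤1+x))

durfee-split : ∀ {xs} → Decreasing xs → ∀ i →
               ∃₂ λ t b → xs ≡ t ++ b × All (λ x → i + length t ≤ suc x) t × All (_< i + length t) b
durfee-split {[]}     _ i = [] , [] , refl , [] , []
durfee-split {x ∷ xs} d i with i ≤? x
... | no i≰x = [] , x ∷ xs , refl , [] , All.map (λ y<i → ≤-trans y<i (m≤m+n i 0)) (x<i ∷ xs<i)
  where
  x<i : x < i
  x<i = ≰⇒> i≰x
  xs<i : All (_< i) xs
  xs<i = All.map (λ y≤x → ≤-<-trans y≤x x<i) (decreasing-∷⁻ d)
... | yes i≤x with t , b , refl , ts , bs ← durfee-split (Linked.tail d) (suc i) =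
  x ∷ t , b , refl ,
  headReaches t ts (All.++⁻ˡ t (decreasing-∷⁻ d)) ∷ All.map (λ {y} → subst (_≤ suc y) (shift t)) ts ,
  All.map (λ {y} → subst (y <_) (shift t)) bs
  where
  shift : ∀ t → suc i + length t ≡ i + suc (length t)
  shift t = sym (+-suc i (length t))
  headReaches : ∀ t → All (λ y → suc i + length t ≤ suc y) t → All (_≤ x) t → i + suc (length t) ≤ suc x
  headReaches []      _       _         = subst (_≤ suc x) (+-comm 1 i) (s≤s i≤x)
  headReaches (y ∷ t) (h ∷ _) (y≤x ∷ _) = ≤-trans (subst (_≤ suc y) (shift (y ∷ t)) h) (s≤s y≤x)

rank-++ : ∀ t {b} → All (length t ≤_) t → All (_≤ length t) b → rank (t ++ b) ≡ length t
rank-++ t ts bs = durfeeFrom-++ t refl (All.map s≤s ts) (All.map s≤s bs)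

rank-split : ∀ {v} → Decreasing v →
             ∃₂ λ t b → v ≡ t ++ b × length t ≡ rank v × All (length t ≤_) t × All (_≤ length t) b
rank-split d with t , b , refl , ts , bs ← durfee-split d 1 =
  t , b , refl , sym (rank-++ t ts′ bs′) , ts′ , bs′
  where
  ts′ : All (length t ≤_) t
  ts′ = All.map ≤-pred ts
  bs′ : All (_≤ length t) b
  bs′ = All.map ≤-pred bs

-- Partitions of given rank and perimeter

perimeter≡⇔ : ∀ x xs m → perimeter (suc x ∷ xs) ≡ 2 * suc m + 2 ⇔ x + length xs ≡ m
perimeter≡⇔ x xs m = mk⇔
  (λ eq → suc-injective (*-cancelˡ-≡ _ _ 2 (+-cancelʳ-≡ 2 _ _ (trans (sym perimeter-∷) eq))))
  (λ eq → trans perimeter-∷ (cong (λ k → 2 * suc k + 2) eq))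
  where
  double-suc+suc : ∀ a b → 2 * (suc a + suc b) ≡ 2 * suc (a + b) + 2
  double-suc+suc = solve-∀
  perimeter-∷ : perimeter (suc x ∷ xs) ≡ 2 * suc (x + length xs) + 2
  perimeter-∷ = double-suc+suc x (length xs)

module RankDecomposition (p : ℕ) where

  -- tops a: the first p + 1 parts of the partitions of rank p + 1 with largest part a + 1;
  -- bottoms j: the remaining parts of those with j + 1 parts.
  tops : ℕ → List (List ℕ)
  tops a with p ≤? a
  ... | yes _ = map (suc a ∷_) (decreasingLists p (suc p) (a ∸ p))
  ... | no  _ = []

  bottoms : ℕ → List (List ℕ)
  bottoms j with p ≤? j
  ... | yes _ = decreasingLists (j ∸ p) 1 p
  ... | no  _ = []

  ∈-tops⁻ : ∀ a {t} → t ∈ tops a →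
            ∃ λ ds → t ≡ suc a ∷ ds × length ds ≡ p × Decreasing t × All (suc p ≤_) t
  ∈-tops⁻ a t∈ with p ≤? a
  ... | yes p≤a
    with ds , ds∈ , refl ← ∈-map⁻ (suc a ∷_) t∈
    with |ds| , dds , bounds ← ∈-decreasingLists⁻ p (suc p) (a ∸ p) ds∈ =
    ds , refl , |ds| ,
    decreasing-∷⁺ (All.map (λ {y} (_ , y≤) → subst (y ≤_) (cong suc (m+[n∸m]≡n p≤a)) y≤) bounds) dds ,
    s≤s p≤a ∷ All.map proj₁ bounds

  ∈-tops⁺ : ∀ {a ds} → length ds ≡ p → Decreasing (suc a ∷ ds) → All (suc p ≤_) (suc a ∷ ds) →
            suc a ∷ ds ∈ tops a
  ∈-tops⁺ {a} {ds} |ds| d (s≤s p≤a ∷ bigs) with p ≤? a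
  ... | yes _   =
    ∈-map⁺ (suc a ∷_) (∈-decreasingLists⁺ p (suc p) (a ∸ p) (|ds| , Linked.tail d , All.zip (bigs , smalls)))
    where
    smalls : All (_≤ suc p + (a ∸ p)) ds
    smalls = All.map (λ {y} y≤ → subst (y ≤_) (sym (cong suc (m+[n∸m]≡n p≤a))) y≤) (decreasing-∷⁻ d)
  ... | no p≰a = contradiction p≤a p≰a

  ∈-bottoms⁻ : ∀ j {b} → b ∈ bottoms j → j ≡ p + length b × Decreasing b × All (λ x → 1 ≤ x × x ≤ suc p) b
  ∈-bottoms⁻ j b∈ with p ≤? j
  ... | yes p≤j with |b| , db , bounds ← ∈-decreasingLists⁻ (j ∸ p) 1 p b∈ =
    trans (sym (m+[n∸m]≡n p≤j)) (cong (p +_) (sym |b|)) , db , bounds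

  ∈-bottoms⁺ : ∀ {b} → Decreasing b → All (λ x → 1 ≤ x × x ≤ suc p) b → b ∈ bottoms (p + length b)
  ∈-bottoms⁺ {b} db bounds with p ≤? p + length b
  ... | yes _  = ∈-decreasingLists⁺ (p + length b ∸ p) 1 p (sym (m+n∸m≡n p (length b)) , db , bounds)
  ... | no p≰ = contradiction (m≤m+n p (length b)) p≰

  length-tops : ∀ a → length (tops a) ≡ a C p
  length-tops a with p ≤? a
  ... | yes p≤a = trans (length-map (suc a ∷_) (decreasingLists p (suc p) (a ∸ p)))
                        (trans (length-decreasingLists p (suc p) (a ∸ p)) (cong (_C p) (m∸n+n≡m p≤a)))
  ... | no p≰a  = sym (k>n⇒nCk≡0 (≰⇒> p≰a))

  length-bottoms : ∀ j → length (bottoms j) ≡ j C p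
  length-bottoms j with p ≤? j
  ... | yes p≤j = begin
    length (decreasingLists (j ∸ p) 1 p) ≡⟨ length-decreasingLists (j ∸ p) 1 p ⟩
    (p + (j ∸ p)) C (j ∸ p)              ≡⟨ cong (_C (j ∸ p)) (m+[n∸m]≡n p≤j) ⟩
    j C (j ∸ p)                          ≡⟨ nCk≡nC[n∸k] p≤j ⟨
    j C p                                ∎
    where open ≡-Reasoning
  ... | no p≰j  = sym (k>n⇒nCk≡0 (≰⇒> p≰j))

  tops-unique : ∀ a → Unique (tops a)
  tops-unique a with p ≤? a
  ... | yes _ = Unique.map⁺ ∷-injectiveʳ (decreasingLists-unique p (suc p) (a ∸ p))
  ... | no  _ = []

  bottoms-unique : ∀ j → Unique (bottoms j)
  bottoms-unique j with p ≤? j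
  ... | yes _ = decreasingLists-unique (j ∸ p) 1 p
  ... | no  _ = []

  length-∈-tops : ∀ a → All (λ t → length t ≡ suc p) (tops a)
  length-∈-tops a = All.tabulate length-t
    where
    length-t : ∀ {t} → t ∈ tops a → length t ≡ suc p
    length-t t∈ with _ , refl , |ds| , _ ← ∈-tops⁻ a t∈ = cong suc |ds|

  block : ℕ → ℕ → List (List ℕ)
  block a j = cartesianProductWith _++_ (tops a) (bottoms j)

  partitions : ℕ → List (List ℕ)
  partitions = antidiagonalConcat block

  largestPart-∈-block : ∀ {a j v} → v ∈ block a j → largestPart v ≡ suc a
  largestPart-∈-block {a} {j} v∈
    with _ , _ , t∈ , _ , refl ← ∈-cartesianProductWith⁻ _++_ (tops a) (bottoms j) v∈
    with _ , refl , _ ← ∈-tops⁻ a t∈ = refl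

  partitions-unique : ∀ m → Unique (partitions m)
  partitions-unique m = antidiagonalConcat-unique block m
    (λ a j → cartesianProductWith-++-unique (length-∈-tops a) (tops-unique a) (bottoms-unique j))
    (λ v∈ v∈′ → suc-injective (trans (sym (largestPart-∈-block v∈)) (largestPart-∈-block v∈′)))

  length-partitions : ∀ m → length (partitions m) ≡ suc m C suc (p + p)
  length-partitions m = begin
    length (partitions m)                          ≡⟨ length-antidiagonalConcat block m ⟩
    antidiagonalSum (λ a j → length (block a j)) m ≡⟨ antidiagonalSum-cong m length-block ⟩
    antidiagonalSum (λ a j → (a C p) * (j C p)) m  ≡⟨ antidiagonalSum-binomial m p p ⟩
    suc m C suc (p + p)                            ∎
    where
    open ≡-Reasoning
    length-block : ∀ a j → length (block a j) ≡ (a C p) * (j C p)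
    length-block a j = trans (length-cartesianProductWith _++_ (tops a) (bottoms j))
                             (cong₂ _*_ (length-tops a) (length-bottoms j))

  ∈-partitions⁻ : ∀ {m v} → v ∈ partitions m →
                  IsNonemptyPartition v × perimeter v ≡ 2 * suc m + 2 × rank v ≡ suc p
  ∈-partitions⁻ {m} v∈
    with a , j , a+j≡m , v∈block ← ∈-antidiagonalConcat⁻ block m v∈
    with t , b , t∈ , b∈ , refl ← ∈-cartesianProductWith⁻ _++_ (tops a) (bottoms j) v∈block
    with ds , refl , refl , dt , tbig ← ∈-tops⁻ a t∈
    with refl , db , bbounds ← ∈-bottoms⁻ j b∈ =
    partition ,
    Equivalence.from (perimeter≡⇔ a (ds ++ b) m) (trans (cong (a +_) (length-++ ds)) a+j≡m) ,
    rank-++ (suc a ∷ ds) tbig (All.map proj₂ bbounds)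
    where
    partition : IsNonemptyPartition (suc a ∷ ds ++ b)
    partition = record
      { nonempty   = s≤s z≤n
      ; positive   = All.++⁺ (All.map (≤-trans (s≤s z≤n)) tbig) (All.map proj₁ bbounds)
      ; decreasing = decreasing-++⁺ tbig (All.map proj₂ bbounds) dt db
      }

  ∈-partitions⁺ : ∀ {m v} → IsNonemptyPartition v → perimeter v ≡ 2 * suc m + 2 → rank v ≡ suc p →
                  v ∈ partitions m
  ∈-partitions⁺ {m} part per rk with rank-split (IsNonemptyPartition.decreasing part)
  ... | [] , _ , refl , |t|≡rank , _ = contradiction (trans |t|≡rank rk) λ ()
  ... | zero ∷ _ , _ , refl , _ , () ∷ _ , _
  ... | suc a ∷ ds , b , refl , |t|≡rank , tbig , bsmall with refl ← trans |t|≡rank rk =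
    ∈-antidiagonalConcat⁺ block a+j≡m
      (∈-cartesianProductWith⁺ _++_ (∈-tops⁺ refl dt tbig) (∈-bottoms⁺ db bbounds))
    where
    open IsNonemptyPartition part
    dt : Decreasing (suc a ∷ ds)
    dt = decreasing-++⁻ˡ (suc a ∷ ds) decreasing
    db : Decreasing b
    db = decreasing-++⁻ʳ (suc a ∷ ds) decreasing
    bbounds : All (λ x → 1 ≤ x × x ≤ suc p) b
    bbounds = All.zip (All.++⁻ʳ (suc a ∷ ds) positive , bsmall)
    a+j≡m : a + (length ds + length b) ≡ m
    a+j≡m = trans (cong (a +_) (sym (length-++ ds))) (Equivalence.to (perimeter≡⇔ a (ds ++ b) m) per)

theorem5p10 : (n r : ℕ) → 1 ≤ n → 1 ≤ r →
    Σ (List (List ℕ)) λ L →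
    Unique L ×
    ((λs : List ℕ) →
    (λs ∈ L) ⇔ (IsNonemptyPartition λs × perimeter λs ≡ 2 * n + 2 × rank λs ≡ r)) ×
    length L ≡ n C (2 * r ∸ 1)
theorem5p10 (suc m) (suc p) _ _ =
  partitions m ,
  partitions-unique m ,
  (λ v → mk⇔ ∈-partitions⁻ (λ (part , per , rk) → ∈-partitions⁺ part per rk)) ,
  trans (length-partitions m) (cong (suc m C_) (sym 2[1+p]∸1≡1+p+p))
  where
  open RankDecomposition p
  2[1+p]∸1≡1+p+p : 2 * suc p ∸ 1 ≡ suc (p + p)
  2[1+p]∸1≡1+p+p = trans (+-suc p (p + 0)) (cong (suc ∘ (p +_)) (+-identityʳ p))
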